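{- Suppose every rule for $f$ is in de Simone format and the equation $x\parallel y\approx f(x,y)+f(y,x)$ holds modulo bisimilarity. Then: (1) $f$ has a rule of the form $\dfrac{x_1\xrightarrow{\beta}y_1\quad x_2\xrightarrow{\bar\beta}y_2}{f(x_1,x_2)\xrightarrow{\tau}t(y_1,y_2)}$ for some $\beta\in\{a,\bar a\}$ and some term $t$; (2) for every rule of $f$ of this form, the term $t(x,y)$ (obtained by replacing $y_1,y_2$ with $x,y$) is bisimilar to $x\parallel y$.
   Context: Actions: $\mathcal A=\{a,\bar a,\tau\}$ with $a\ne\bar a$, $\bar{\bar a}=a$. CCS$_f$ terms: $t::=\mathbf 0\mid x\mid \mu.t\mid t+t\mid t\parallel t\mid f(t,t)$. Semantics on closed terms: - $\mu.x\xrightarrow{\mu}x$; - from $x\xrightarrow{\mu}x'$ infer $x+y\xrightarrow{\mu}x'$, $y+x\xrightarrow{\mu}x'$, $x\parallel y\xrightarrow{\mu}x'\parallel y$ and $y\parallel x\xrightarrow{\mu}y\parallel x'$; - from $x\xrightarrow{\beta}x'$ and $y\xrightarrow{\bar\beta}y'$ ($\beta\in\{a,\bar a\}$) infer $x\parallel y\xrightarrow{\tau}x'\parallel y'$; - the rules for $f$. A rule for $f$ is in de Simone format if it has premises $\{x_i\xrightarrow{\mu_i}y_i\mid i\in I\}$ with $I\subseteq\{1,2\}$ and conclusion $f(x_1,x_2)\xrightarrow{\mu}t$, where the variables $x_1,x_2,y_i$ are pairwise distinct, and $t$ is a CCS$_f$ term over them with each variable occurring at most once and no $x_i$ ($i\in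 I$) occurring. $\underline{\leftrightarrow}$ is strong bisimilarity; an equation $t\approx u$ holds modulo bisimilarity if $\sigma(t)\,\underline{\leftrightarrow}\,\sigma(u)$ for all closed substitutions $\sigma$. For open terms, $t\,\underline{\leftrightarrow}\,u$ means the same. -}

module Defs where

open import Data.Nat using (ℕ; zero; suc; _+_; _≤_)
open import Data.Maybe using (Maybe; just; nothing)
open import Data.Empty using (⊥)
open import Data.Product using (Σ; ∃; _×_; _,_)
open import Relation.Binary.PropositionalEquality using (_≡_)
open import Relation.Nullary using (¬_)

data Act : Set where
  a ā τ : Act

data Visible : Act → Set where
  vis-a : Visible a
  vis-ā : Visible ā

bar : Act → Act
bar a = ā
bar ā = a
bar τ = τ   -- never used on τ: only applied to visible actions

infixr 20 _·_
infixl 15 _⊕_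
infixl 16 _∥_

data Term (V : Set) : Set where
  𝟎   : Term V
  var : V → Term V
  _·_ : Act → Term V → Term V
  _⊕_ : Term V → Term V → Term V
  _∥_ : Term V → Term V → Term V
  f   : Term V → Term V → Term V

Closed : Set
Closed = Term ⊥

sub : {V W : Set} → (V → Term W) → Term V → Term W
sub σ 𝟎 = 𝟎
sub σ (var v) = σ v
sub σ (μ · t) = μ · sub σ t
sub σ (t ⊕ u) = sub σ t ⊕ sub σ u
sub σ (t ∥ u) = sub σ t ∥ sub σ u
sub σ (f t u) = f (sub σ t) (sub σ u)

-- Rules for f.  Variables of a rule: x₁ x₂ (arguments), y₁ y₂ (targets
-- of the premises); these are pairwise distinct by construction.

data RVar : Set where
  x₁ x₂ y₁ y₂ : RVar

eqRVar : RVar → RVar → ℕ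
eqRVar x₁ x₁ = 1
eqRVar x₂ x₂ = 1
eqRVar y₁ y₁ = 1
eqRVar y₂ y₂ = 1
eqRVar _ _ = 0

occ : RVar → Term RVar → ℕ
occ v 𝟎 = 0
occ v (var w) = eqRVar v w
occ v (μ · t) = occ v t
occ v (t ⊕ u) = occ v t + occ v u
occ v (t ∥ u) = occ v t + occ v u
occ v (f t u) = occ v t + occ v u

-- A rule  { x_i -μ_i-> y_i | i ∈ I }  /  f(x₁,x₂) -μ-> t :
-- prem₁ = just μ₁ iff 1 ∈ I (premise x₁ -μ₁-> y₁), likewise prem₂.
record Rule : Set where
  constructor rule
  field
    prem₁  : Maybe Act
    prem₂  : Maybe Act
    act    : Act
    target : Term RVar
open Rule public

-- x_i may occur in the target only if i ∉ I;
-- y_i may occur in the target only if i ∈ I (it is a variable of the rule only then).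
NoX : Maybe Act → RVar → Term RVar → Set
NoX (just _) v t = occ v t ≡ 0
NoX nothing  v t = occ v t ≤ 1

NoY : Maybe Act → RVar → Term RVar → Set
NoY (just _) v t = occ v t ≤ 1
NoY nothing  v t = occ v t ≡ 0

DeSimone : Rule → Set
DeSimone r =
  NoX (prem₁ r) x₁ (target r) × NoX (prem₂ r) x₂ (target r) ×
  NoY (prem₁ r) y₁ (target r) × NoY (prem₂ r) y₂ (target r)

module Semantics (R : Rule → Set) where

  mutual
    data Step : Closed → Act → Closed → Set where
      pre  : ∀ {μ p} → Step (μ · p) μ p
      sumˡ : ∀ {p q μ p'} → Step p μ p' → Step (p ⊕ q) μ p'
      sumʳ : ∀ {p q μ p'} → Step p μ p' → Step (q ⊕ p) μ p'
      parˡ : ∀ {p q μ p'} → Step p μ p' → Step (p ∥ q) μ (p' ∥ q)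
      parʳ : ∀ {p q μ p'} → Step p μ p' → Step (q ∥ p) μ (q ∥ p')
      com  : ∀ {β p p' q q'} → Visible β → Step p β p' → Step q (bar β) q' →
             Step (p ∥ q) τ (p' ∥ q')
      frule : ∀ {r} → R r → ∀ {p₁ p₂ q₁ q₂} →
              Prem (prem₁ r) p₁ q₁ → Prem (prem₂ r) p₂ q₂ →
              Step (f p₁ p₂) (act r) (sub (inst p₁ p₂ q₁ q₂) (target r))

    data Prem : Maybe Act → Closed → Closed → Set where
      none : ∀ {p q} → Prem nothing p q
      some : ∀ {μ p q} → Step p μ q → Prem (just μ) p q

    inst : Closed → Closed → Closed → Closed → RVar → Closed
    inst p₁ p₂ q₁ q₂ x₁ = p₁
    inst p₁ p₂ q₁ q₂ x₂ = p₂
    inst p₁ p₂ q₁ q₂ y₁ = q₁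
    inst p₁ p₂ q₁ q₂ y₂ = q₂

  IsBisimulation : (Closed → Closed → Set) → Set
  IsBisimulation B =
    ∀ p q → B p q →
      (∀ μ p' → Step p μ p' → Σ Closed λ q' → Step q μ q' × B p' q') ×
      (∀ μ q' → Step q μ q' → Σ Closed λ p' → Step p μ p' × B p' q')

  _↔_ : Closed → Closed → Set₁
  p ↔ q = Σ (Closed → Closed → Set) λ B → IsBisimulation B × B p q

data Var2 : Set where
  vx vy : Var2

x y : Term Var2
x = var vx
y = var vy

-- For a rule with premises on both arguments, t(x,y) is its target with
-- y₁ := x, y₂ := y (x₁, x₂ do not occur by de Simone; we map them to 𝟎).
tXY : Closed → Closed → Term RVar → Closed
tXY p q t = sub (λ { x₁ → 𝟎 ; x₂ → 𝟎 ; y₁ → p ; y₂ → q }) t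

module Submission where

open import Defs
open import Data.Maybe using (just)
open import Data.Product using (Σ; _×_; _,_; proj₁; proj₂; map₂)
open import Data.Empty using (⊥-elim)
open import Data.Nat using (_+_)
open import Data.Nat.Properties using (m+n≡0⇒m≡0; m+n≡0⇒n≡0)
open import Relation.Nullary using (¬_)
open import Relation.Binary.PropositionalEquality using (_≡_; refl; subst₂; cong; cong₂)

-- Instantiate x, y by prefixes.  With x := a.0, y := ā.0 the τ-step of x ∥ y must be
-- matched by a rule for f firing on (a.0, ā.0) or (ā.0, a.0).  A premise-free argument could be
-- replaced by 0 without disabling the rule, yet 0 ∥ ā.0 (say) has no τ-step; so the rule tests
-- both arguments, with complementary actions.  For such a rule and x := β.p, y := β̄.q, the
-- step f(β.p, β̄.q) -τ-> t(p,q) must be matched by x ∥ y, whose only τ-step goes to p ∥ q.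

bar-visible : ∀ {β} → Visible β → Visible (bar β)
bar-visible vis-a = vis-ā
bar-visible vis-ā = vis-a

module _ {W : Set} {σ ρ : RVar → Term W} (σ≡ρ-y₁ : σ y₁ ≡ ρ y₁) (σ≡ρ-y₂ : σ y₂ ≡ ρ y₂) where

  sub-cong-without-x : ∀ t → occ x₁ t ≡ 0 → occ x₂ t ≡ 0 → sub σ t ≡ sub ρ t
  sub-cong-without-xˡ : ∀ t u → occ x₁ t + occ x₁ u ≡ 0 → occ x₂ t + occ x₂ u ≡ 0 →
                        sub σ t ≡ sub ρ t
  sub-cong-without-xˡ t _ h₁ h₂ =
    sub-cong-without-x t (m+n≡0⇒m≡0 (occ x₁ t) h₁) (m+n≡0⇒m≡0 (occ x₂ t) h₂)

  sub-cong-without-xʳ : ∀ t u → occ x₁ t + occ x₁ u ≡ 0 → occ x₂ t + occ x₂ u ≡ 0 →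
                        sub σ u ≡ sub ρ u
  sub-cong-without-xʳ t u h₁ h₂ =
    sub-cong-without-x u (m+n≡0⇒n≡0 (occ x₁ t) h₁) (m+n≡0⇒n≡0 (occ x₂ t) h₂)

  sub-cong-without-x 𝟎        _  _  = refl
  sub-cong-without-x (var x₁) () _
  sub-cong-without-x (var x₂) _  ()
  sub-cong-without-x (var y₁) _  _  = σ≡ρ-y₁
  sub-cong-without-x (var y₂) _  _  = σ≡ρ-y₂
  sub-cong-without-x (μ · t) h₁ h₂ = cong (μ ·_) (sub-cong-without-x t h₁ h₂)
  sub-cong-without-x (t ⊕ u) h₁ h₂ = cong₂ _⊕_
    (sub-cong-without-xˡ t u h₁ h₂) (sub-cong-without-xʳ t u h₁ h₂)
  sub-cong-without-x (t ∥ u) h₁ h₂ = cong₂ _∥_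
    (sub-cong-without-xˡ t u h₁ h₂) (sub-cong-without-xʳ t u h₁ h₂)
  sub-cong-without-x (f t u) h₁ h₂ = cong₂ f
    (sub-cong-without-xˡ t u h₁ h₂) (sub-cong-without-xʳ t u h₁ h₂)

module _ (R : Rule → Set) where
  open Semantics R

  ↔-sym : ∀ {p q} → p ↔ q → q ↔ p
  ↔-sym (B , isB , Bpq) =
    (λ u v → B v u) , (λ u v Bvu → proj₂ (isB v u Bvu) , proj₁ (isB v u Bvu)) , Bpq

  ↔-stepˡ : ∀ {p q μ p'} → p ↔ q → Step p μ p' → Σ Closed λ q' → Step q μ q' × p' ↔ q'
  ↔-stepˡ (B , isB , Bpq) st with proj₁ (isB _ _ Bpq) _ _ st
  ... | q' , st' , Bp'q' = q' , st' , (B , isB , Bp'q')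

  ∥≈f⊕f : Set₁
  ∥≈f⊕f = ∀ (σ : Var2 → Closed) → sub σ (x ∥ y) ↔ sub σ (f x y ⊕ f y x)

  f-step⇒∥-step : ∥≈f⊕f → ∀ {p q μ s} → Step (f p q) μ s →
                  Σ Closed λ s' → Step (p ∥ q) μ s' × s ↔ s'
  f-step⇒∥-step hyp {p} {q} st = ↔-stepˡ (↔-sym (hyp λ { vx → p ; vy → q })) (sumˡ st)

  prefix∥𝟎-no-τ : ∀ {μ p s} → Visible μ → ¬ Step (μ · p ∥ 𝟎) τ s
  prefix∥𝟎-no-τ vis-a (parˡ ())
  prefix∥𝟎-no-τ vis-ā (parˡ ())
  prefix∥𝟎-no-τ _     (com _ _ ())

  𝟎∥prefix-no-τ : ∀ {μ q s} → Visible μ → ¬ Step (𝟎 ∥ μ · q) τ s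
  𝟎∥prefix-no-τ vis-a (parʳ ())
  𝟎∥prefix-no-τ vis-ā (parʳ ())
  𝟎∥prefix-no-τ _     (com _ () _)

  prefix∥co-prefix-τ⁻¹ : ∀ {β p q s} → Visible β → Step (β · p ∥ bar β · q) τ s → s ≡ p ∥ q
  prefix∥co-prefix-τ⁻¹ vis-a (parˡ ())
  prefix∥co-prefix-τ⁻¹ vis-a (parʳ ())
  prefix∥co-prefix-τ⁻¹ vis-a (com _ pre pre) = refl
  prefix∥co-prefix-τ⁻¹ vis-ā (parˡ ())
  prefix∥co-prefix-τ⁻¹ vis-ā (parʳ ())
  prefix∥co-prefix-τ⁻¹ vis-ā (com _ pre pre) = refl

  ComplementaryτRule : Rule → Act → Set
  ComplementaryτRule r β =
    R r × Visible β × prem₁ r ≡ just β × prem₂ r ≡ just (bar β) × act r ≡ τ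

  complementaryτRule-of-step : ∥≈f⊕f → ∀ {β s} → Visible β →
    Step (f (β · 𝟎) (bar β · 𝟎)) τ s → Σ Rule λ r → ComplementaryτRule r β
  complementaryτRule-of-step hyp v (frule {rule _ _ .τ t} Rr (some pre) (some pre)) =
    rule _ _ τ t , Rr , v , refl , refl , refl
  complementaryτRule-of-step hyp v (frule {rule _ _ .τ _} Rr none P₂) =
    ⊥-elim (𝟎∥prefix-no-τ (bar-visible v)
      (proj₁ (proj₂ (f-step⇒∥-step hyp (frule Rr {p₁ = 𝟎} {q₁ = 𝟎} none P₂)))))
  complementaryτRule-of-step hyp v (frule {rule _ _ .τ _} Rr P₁@(some pre) none) =
    ⊥-elim (prefix∥𝟎-no-τ v
      (proj₁ (proj₂ (f-step⇒∥-step hyp (frule Rr {p₂ = 𝟎} {q₂ = 𝟎} P₁ none)))))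

  complementaryτRule-exists : ∥≈f⊕f → Σ Rule λ r → Σ Act λ β → ComplementaryτRule r β
  complementaryτRule-exists hyp
    with ↔-stepˡ (hyp λ { vx → a · 𝟎 ; vy → ā · 𝟎 }) (com vis-a pre pre)
  ... | _ , sumˡ st , _ = map₂ (a ,_) (complementaryτRule-of-step hyp vis-a st)
  ... | _ , sumʳ st , _ = map₂ (ā ,_) (complementaryτRule-of-step hyp vis-ā st)

  complementaryτRule-target↔∥ : (∀ r → R r → DeSimone r) → ∥≈f⊕f →
    ∀ r β → ComplementaryτRule r β → ∀ p q → tXY p q (target r) ↔ (p ∥ q)
  complementaryτRule-target↔∥ deSimone hyp
    r@(rule (just β) (just .(bar β)) .τ t) .β (Rr , v , refl , refl , refl) p q
    with deSimone r Rr
       | f-step⇒∥-step hyp (frule Rr {p₁ = β · p} {p₂ = bar β · q} (some pre) (some pre))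
  ... | no-x₁ , no-x₂ , _ | s , st , target↔s =
    subst₂ _↔_ (sub-cong-without-x refl refl t no-x₁ no-x₂) (prefix∥co-prefix-τ⁻¹ v st) target↔s

lemma4 : (R : Rule → Set) → (∀ r → R r → DeSimone r) →
    (∀ (σ : Var2 → Closed) → Semantics._↔_ R (sub σ (x ∥ y)) (sub σ (f x y ⊕ f y x))) →
    (Σ Rule λ r → Σ Act λ β → R r × Visible β × prem₁ r ≡ just β × prem₂ r ≡ just (bar β) × act r ≡ τ)
    × (∀ r β → R r → Visible β → prem₁ r ≡ just β → prem₂ r ≡ just (bar β) → act r ≡ τ →
         ∀ (p q : Closed) → Semantics._↔_ R (tXY p q (target r)) (p ∥ q))
lemma4 R deSimone hyp =
    complementaryτRule-exists R hyp
  , λ r β Rr v e₁ e₂ e₃ → complementaryτRule-target↔∥ R deSimone hyp r β (Rr , v , e₁ , e₂ , e₃)
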